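{- Let $\kappa\le\lambda$ be infinite cardinals. If $(f,g)$ is a dense Chu transform from a Chu space $\langle X,r,A\rangle$ to a Chu space $\langle Y,s,B\rangle$ and $\langle X,r,A\rangle$ is $\langle\kappa,\lambda\rangle$-absolutely closed, then $\langle Y,s,B\rangle$ is $\langle\kappa,\lambda\rangle$-absolutely closed.
   Context: A Chu space is a triple $\langle X,r,A\rangle$ with $r\subseteq X\times A$. A Chu transform from $\langle X,r,A\rangle$ to $\langle Y,s,B\rangle$ is a pair $f\colon X\to Y$, $g\colon B\to A$ such that $\langle x,g(b)\rangle\in r\iff\langle f(x),b\rangle\in s$ for all $x\in X$, $b\in B$; it is dense if for every $b\in B$, if some $y\in Y$ has $\langle y,b\rangle\in s$, then some $x\in X$ has $\langle f(x),b\rangle\in s$. For infinite cardinals $\kappa\le\lambda$, a Chu space $\langle X,r,A\rangle$ is $\langle\kappa,\lambda\rangle$-absolutely closed if it satisfies the two-sorted infinitary sentence \[ \forall\langle v^\mathsf{s}_\alpha:\alpha<\lambda\rangle\Bigl[\exists v^\mathsf{p}\bigwedge_{\alpha<\lambda}\lnot R(v^\mathsf{p},v^\mathsf{s}_\alpha)\ \lor\bigvee_{Z\in[\lambda]^{<\kappa}}\forall v^\mathsf{s}\bigl[\lnot\exists v^\mathsf{p}R(v^\mathsf{p},v^\mathsf{s})\lor\exists v^\mathsf{p}\bigl(R(v^\mathsf{p},v^\mathsf{s})\land\bigvee_{\alpha\in Z}R(v^\mathsf{p},v^\mathsf{s}_\alpha)\bigr)\bigr]\Bigr], \] i.e. for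 every sequence $\langle a_\alpha:\alpha<\lambda\rangle$ in $A$, either some $x\in X$ has $\langle x,a_\alpha\rangle\notin r$ for all $\alpha$, or there is $Z\subseteq\lambda$, $|Z|<\kappa$, such that for every $a\in A$, either no $x\in X$ has $\langle x,a\rangle\in r$, or some $x\in X$ has $\langle x,a\rangle\in r$ and $\langle x,a_\alpha\rangle\in r$ for some $\alpha\in Z$. (Here $v^\mathsf{p}$ ranges over points, $v^\mathsf{s}$ over states, $R$ is interpreted as $r$.) -}

module Defs where

open import Data.Nat using (ℕ)
open import Data.Product using (Σ; Σ-syntax; ∃; _×_; _,_)
open import Data.Sum using (_⊎_)
open import Relation.Nullary using (¬_)
open import Function.Bundles using (_↣_)

-- Cardinals are represented by (index) types; cardinal comparison via injections.
_≼_ : Set → Set → Set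
A ≼ B = A ↣ B

_≺_ : Set → Set → Set
A ≺ B = (A ≼ B) × ¬ (B ≼ A)

Infinite : Set → Set
Infinite K = ℕ ≼ K

Subset : Set → Set₁
Subset L = L → Set

⟦_⟧ˢ : {L : Set} → Subset L → Set
⟦_⟧ˢ {L} Z = Σ L Z

record Chu : Set₁ where
  field
    Pt  : Set
    St  : Set
    rel : Pt → St → Set
open Chu public

record ChuTransform (C D : Chu) : Set where
  field
    f   : Pt C → Pt D
    g   : St D → St C
    adj : ∀ (x : Pt C) (b : St D) → (rel C x (g b) → rel D (f x) b) × (rel D (f x) b → rel C x (g b))
open ChuTransform public

Dense : {C D : Chu} → ChuTransform C D → Set
Dense {C} {D} t = ∀ (b : St D) → (Σ[ y ∈ Pt D ] rel D y b) → Σ[ x ∈ Pt C ] rel D (f t x) b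

-- ⟨κ,λ⟩-absolutely closed, with κ, λ given by types K, L (L indexes the sequences)
AbsClosed : (K L : Set) → Chu → Set₁
AbsClosed K L C =
  ∀ (a : L → St C) →
    (Σ[ x ∈ Pt C ] (∀ (α : L) → ¬ rel C x (a α)))
    ⊎ (Σ[ Z ∈ Subset L ] (⟦ Z ⟧ˢ ≺ K) ×
         (∀ (a' : St C) →
            (¬ (Σ[ x ∈ Pt C ] rel C x a'))
            ⊎ (Σ[ x ∈ Pt C ] (rel C x a' × (Σ[ α ∈ L ] (Z α × rel C x (a α)))))))

{-# OPTIONS --safe #-}
module Submission where

open import Defs
open import Data.Product using (Σ; Σ-syntax; _×_; _,_; proj₁; proj₂)
open import Data.Sum using (inj₁; inj₂)
import Data.Sum as Sum
open import Function using (_∘_)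
open import Relation.Nullary using (¬_)

-- Pull the sequence back along g and apply closedness of C; both alternatives
-- push forward along f, and density reflects unrealised states back to D.

module _ {C D : Chu} (t : ChuTransform C D) where

  rel-preserved : ∀ x b → rel C x (g t b) → rel D (f t x) b
  rel-preserved x b = proj₁ (adj t x b)

  rel-reflected : ∀ x b → rel D (f t x) b → rel C x (g t b)
  rel-reflected x b = proj₂ (adj t x b)

  avoiding-point-image : {L : Set} (b : L → St D) (x : Pt C) →
    (∀ α → ¬ rel C x (g t (b α))) → ∀ α → ¬ rel D (f t x) (b α)
  avoiding-point-image b x avoids α = avoids α ∘ rel-reflected x (b α)

  unrealised-reflected : Dense t → ∀ b →
    ¬ (Σ[ x ∈ Pt C ] rel C x (g t b)) → ¬ (Σ[ y ∈ Pt D ] rel D y b)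
  unrealised-reflected dense b unrealised realised =
    let (x , xb) = dense b realised in unrealised (x , rel-reflected x b xb)

  joint-witness-image : {L : Set} (b : L → St D) (Z : Subset L) (b' : St D) →
    (Σ[ x ∈ Pt C ] (rel C x (g t b') × (Σ[ α ∈ L ] (Z α × rel C x (g t (b α)))))) →
    (Σ[ y ∈ Pt D ] (rel D y b' × (Σ[ α ∈ L ] (Z α × rel D y (b α)))))
  joint-witness-image b Z b' (x , xb' , α , α∈Z , xbα) =
    f t x , rel-preserved x b' xb' , α , α∈Z , rel-preserved x (b α) xbα

  AbsClosed-dense-image : (K L : Set) → Dense t → AbsClosed K L C → AbsClosed K L D
  AbsClosed-dense-image K L dense closed b with closed (g t ∘ b)
  ... | inj₁ (x , avoids) = inj₁ (f t x , avoiding-point-image b x avoids)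
  ... | inj₂ (Z , Z≺K , covers) = inj₂ (Z , Z≺K , λ b' →
          Sum.map (unrealised-reflected dense b') (joint-witness-image b Z b') (covers (g t b')))

corollary4p9 : (K L : Set) → Infinite K → Infinite L → K ≼ L →
    (C D : Chu) (t : ChuTransform C D) → Dense t →
    AbsClosed K L C → AbsClosed K L D
corollary4p9 K L _ _ _ C D t = AbsClosed-dense-image t K L
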